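{- Let $\mathsf{CS}$ be an axiomatically appropriate constant specification. If $\vdash_{\mathsf{CS}}F$, then there is a justification term $t$ such that $\vdash_{\mathsf{CS}}t:F$.
   Context: Justification terms are built from justification variables $x_1,x_2,\dots$ and justification constants $c,c_1,c_2,\dots$ by binary operations $\cdot$ and $+$. Formulas of $\mathsf{RPLJ}$: $A::=p\mid\bar r\mid A\&A\mid A\to A\mid t:A$ ($p$ a propositional variable, $r\in\mathbb Q\cap[0,1]$, $t$ a term). Abbreviations: $\neg A:=A\to\bar0$, $A\wedge B:=A\&(A\to B)$, $A\equiv B:=(A\to B)\&(B\to A)$, $t\overset{r}{:}A:=(\bar r\to t:A)\wedge(t:A\to\bar r)$. On $[0,1]$: $x*_Ly=\max(0,x+y-1)$, $x\Rightarrow_Ly=\min(1,1-x+y)$. Axiom schemes of $\mathsf{RPLJ}$: (BL1) $(A\to B)\to((B\to C)\to(A\to C))$; (BL2) $(A\&B)\to A$; (BL3) $(A\&B)\to(B\&A)$; (BL4) $(A\&(A\to B))\to(B\&(B\to A))$; (BL5a) $(A\to(B\to C))\to((A\&B)\to C)$; (BL5b) $((A\&B)\to C)\to(A\to(B\to C))$; (BL6) $((A\to B)\to C)\to(((B\to A)\to C)\to C)$; (BL7) $\bar0\to A$; (L) $\neg\neg A\to A$; (TC1) $(\bar r\to\bar{r'})\equiv\overline{r\Rightarrow_Lr'}$; (TC2) $(\bar r\&\bar{r'})\equiv\overline{r*_Lr'}$; (Appl) $s:(A\to B)\to(t:A\to(s\cdot t):B)$; (Sum) $s:A\to(s+t):A$,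 $s:A\to(t+s):A$. A constant specification $\mathsf{CS}$ is a downward closed set of formulas $c_{i_n}\overset{1}{:}\cdots\overset{1}{:}c_{i_1}\overset{1}{:}A$ ($n\ge1$, $c_{i_j}$ constants, $A$ an axiom instance) (with such a formula, $n\ge2$, it contains $c_{i_{n-1}}\overset1:\cdots\overset1:c_{i_1}\overset1:A$). $\mathsf{CS}$ is axiomatically appropriate if for each axiom instance $A$ there is a constant $c$ with $c\overset1:A\in\mathsf{CS}$, and for each $F\in\mathsf{CS}$ there is a constant $c$ with $c\overset1:F\in\mathsf{CS}$. $\mathsf{RPLJ}_{\mathsf{CS}}$ has the axioms above and the rules Modus Ponens and "derive any member of $\mathsf{CS}$"; $\vdash_{\mathsf{CS}}F$ means $F$ is a theorem of $\mathsf{RPLJ}_{\mathsf{CS}}$. -}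

module Defs where

open import Data.Nat using (ℕ)
open import Data.Product using (Σ; _,_)
open import Data.Rational using (ℚ; 0ℚ; 1ℚ; _≤_; _+_; _-_; -_; _⊔_; _⊓_)
open import Data.Rational.Properties
  using (≤-refl; ≤-trans; ≤-reflexive; +-mono-≤; +-monoˡ-≤; +-inverseʳ;
         p⊓q≤p; p≤p⊔q; ⊔-lub; ⊓-glb)
open import Relation.Binary.PropositionalEquality using (_≡_; refl; sym)

record UI : Set where
  constructor mkUI
  field
    val  : ℚ
    .lo  : 0ℚ ≤ val
    .hi  : val ≤ 1ℚ
open UI public

private
  0≤1 : 0ℚ ≤ 1ℚ
  0≤1 = Data.Rational.*≤* (Data.Integer.+≤+ Data.Nat.z≤n)
    where import Data.Integer ; import Data.Nat

  0≤1-x : ∀ x → x ≤ 1ℚ → 0ℚ ≤ 1ℚ - x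
  0≤1-x x x≤1 = ≤-trans (≤-reflexive (sym (+-inverseʳ x))) (+-monoˡ-≤ (- x) x≤1)

  0≤1-x+y : ∀ x y → x ≤ 1ℚ → 0ℚ ≤ y → 0ℚ ≤ (1ℚ - x) + y
  0≤1-x+y x y x≤1 0≤y = +-mono-≤ (0≤1-x x x≤1) 0≤y

  x+y-1≤1 : ∀ x y → x ≤ 1ℚ → y ≤ 1ℚ → (x + y) - 1ℚ ≤ 1ℚ
  x+y-1≤1 x y x≤1 y≤1 =
    ≤-trans (+-monoˡ-≤ (- 1ℚ) (+-mono-≤ x≤1 y≤1)) (≤-refl {1ℚ})

_⇒L_ : UI → UI → UI
mkUI x x0 x1 ⇒L mkUI y y0 y1 =
  mkUI (1ℚ ⊓ ((1ℚ - x) + y)) (⊓-glb 0≤1 (0≤1-x+y x y x1 y0)) (p⊓q≤p 1ℚ ((1ℚ - x) + y))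

_*L_ : UI → UI → UI
mkUI x x0 x1 *L mkUI y y0 y1 =
  mkUI (0ℚ ⊔ ((x + y) - 1ℚ)) (p≤p⊔q 0ℚ ((x + y) - 1ℚ)) (⊔-lub 0≤1 (x+y-1≤1 x y x1 y1))

zeroUI oneUI : UI
zeroUI = mkUI 0ℚ (≤-refl {0ℚ}) 0≤1
oneUI  = mkUI 1ℚ 0≤1 (≤-refl {1ℚ})

infixl 7 _·_
infixl 6 _⊕_

data Tm : Set where
  var   : ℕ → Tm
  const : ℕ → Tm
  _·_   : Tm → Tm → Tm
  _⊕_   : Tm → Tm → Tm

infixr 4 _⇒_
infixr 5 _&_
infix  6 _∶_

data Fm : Set where
  pv  : ℕ → Fm
  tc  : UI → Fm
  _&_ : Fm → Fm → Fm
  _⇒_ : Fm → Fm → Fm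
  _∶_ : Tm → Fm → Fm

⊥̄ : Fm
⊥̄ = tc zeroUI

¬̇_ : Fm → Fm
¬̇ A = A ⇒ ⊥̄

infixr 5 _∧̇_
_∧̇_ : Fm → Fm → Fm
A ∧̇ B = A & (A ⇒ B)

infix 3 _⇔_
_⇔_ : Fm → Fm → Fm
A ⇔ B = (A ⇒ B) & (B ⇒ A)

_∶[_]_ : Tm → UI → Fm → Fm
t ∶[ r ] A = (tc r ⇒ t ∶ A) ∧̇ (t ∶ A ⇒ tc r)

_∶¹_ : Tm → Fm → Fm
t ∶¹ A = t ∶[ oneUI ] A

data Axiom : Fm → Set where
  BL1  : ∀ A B C → Axiom ((A ⇒ B) ⇒ ((B ⇒ C) ⇒ (A ⇒ C)))
  BL2  : ∀ A B → Axiom ((A & B) ⇒ A)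
  BL3  : ∀ A B → Axiom ((A & B) ⇒ (B & A))
  BL4  : ∀ A B → Axiom ((A & (A ⇒ B)) ⇒ (B & (B ⇒ A)))
  BL5a : ∀ A B C → Axiom ((A ⇒ (B ⇒ C)) ⇒ ((A & B) ⇒ C))
  BL5b : ∀ A B C → Axiom (((A & B) ⇒ C) ⇒ (A ⇒ (B ⇒ C)))
  BL6  : ∀ A B C → Axiom (((A ⇒ B) ⇒ C) ⇒ (((B ⇒ A) ⇒ C) ⇒ C))
  BL7  : ∀ A → Axiom (⊥̄ ⇒ A)
  L    : ∀ A → Axiom (¬̇ ¬̇ A ⇒ A)
  TC1  : ∀ r r' → Axiom ((tc r ⇒ tc r') ⇔ tc (r ⇒L r'))
  TC2  : ∀ r r' → Axiom ((tc r & tc r') ⇔ tc (r *L r'))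
  Appl : ∀ s t A B → Axiom (s ∶ (A ⇒ B) ⇒ (t ∶ A ⇒ (s · t) ∶ B))
  Suml : ∀ s t A → Axiom (s ∶ A ⇒ (s ⊕ t) ∶ A)
  Sumr : ∀ s t A → Axiom (s ∶ A ⇒ (t ⊕ s) ∶ A)

data CSShape : Fm → Set where
  base : ∀ c A → Axiom A → CSShape (const c ∶¹ A)
  step : ∀ c F → CSShape F → CSShape (const c ∶¹ F)

record ConstSpec : Set₁ where
  field
    member   : Fm → Set
    shape    : ∀ F → member F → CSShape F
    -- downward closed: with c :¹ F (n ≥ 2, i.e. F itself of CS shape) it contains F
    downward : ∀ c F → member (const c ∶¹ F) → CSShape F → member F
open ConstSpec public

record AxiomaticallyAppropriate (CS : ConstSpec) : Set where
  field
    forAxioms : ∀ A → Axiom A → Σ ℕ (λ c → member CS (const c ∶¹ A))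
    forCS     : ∀ F → member CS F → Σ ℕ (λ c → member CS (const c ∶¹ F))

data _⊢_ (CS : ConstSpec) : Fm → Set where
  ax  : ∀ {A} → Axiom A → CS ⊢ A
  mp  : ∀ {A B} → CS ⊢ (A ⇒ B) → CS ⊢ A → CS ⊢ B
  cs  : ∀ {F} → member CS F → CS ⊢ F

-- The proof is by induction on the derivation of F.
--   * An axiom instance A, or a member A of CS, has by axiomatic
--     appropriateness a constant c with  c :¹ A ∈ CS.  Since  c :¹ A  is the
--     weak conjunction  (1̄ → c:A) ∧ (c:A → 1̄)  and 1̄ is a theorem of
--     Łukasiewicz logic with truth constants, we obtain  ⊢ c : A.
--   * For Modus Ponens from  A → F  and  A , the induction hypotheses give
--     s : (A → F)  and  t : A , and the application axiom yields  (s·t) : F.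

module Submission where

open import Defs
open import Data.Product using (Σ; _,_)

&-elimˡ : ∀ {CS A B} → CS ⊢ (A & B) → CS ⊢ A
&-elimˡ d = mp (ax (BL2 _ _)) d

-- The truth constant 1̄ is a theorem: by TC1,  (0̄ → 0̄) → 1̄  holds, since
-- 0 ⇒L 0 computes to 1, and  0̄ → 0̄  is an instance of BL7.
truth : ∀ {CS} → CS ⊢ tc oneUI
truth = mp (&-elimˡ (ax (TC1 zeroUI zeroUI))) (ax (BL7 ⊥̄))

-- A justification held with degree 1 is a plain justification: the first
-- conjunct of  t :¹ A  is  1̄ → t:A , and 1̄ is a theorem.
certain⇒justified : ∀ {CS t A} → CS ⊢ (t ∶¹ A) → CS ⊢ (t ∶ A)
certain⇒justified d = mp (&-elimˡ d) truth

module _ {CS : ConstSpec} (appropriate : AxiomaticallyAppropriate CS) where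
  open AxiomaticallyAppropriate appropriate

  justify-axiom : ∀ A → Axiom A → Σ Tm (λ t → CS ⊢ (t ∶ A))
  justify-axiom A a with forAxioms A a
  ... | c , c∶¹A∈CS = const c , certain⇒justified (cs c∶¹A∈CS)

  justify-member : ∀ F → member CS F → Σ Tm (λ t → CS ⊢ (t ∶ F))
  justify-member F F∈CS with forCS F F∈CS
  ... | c , c∶¹F∈CS = const c , certain⇒justified (cs c∶¹F∈CS)

justify-mp : ∀ {CS s t A B} →
  CS ⊢ (s ∶ (A ⇒ B)) → CS ⊢ (t ∶ A) → CS ⊢ ((s · t) ∶ B)
justify-mp {s = s} {t} {A} {B} ds dt = mp (mp (ax (Appl s t A B)) ds) dt

lemma7 : (CS : ConstSpec) → AxiomaticallyAppropriate CS →
    ∀ F → CS ⊢ F → Σ Tm (λ t → CS ⊢ (t ∶ F))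
lemma7 CS appropriate F (ax a)  = justify-axiom appropriate F a
lemma7 CS appropriate F (cs m)  = justify-member appropriate F m
lemma7 CS appropriate F (mp {A} dA⇒F dA)
  with lemma7 CS appropriate (A ⇒ F) dA⇒F | lemma7 CS appropriate A dA
... | s , ds | t , dt = s · t , justify-mp ds dt
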